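{- Let $A$ be a finite set of integers with $|A|\ge 3$. Then $$|S_2(A)|=2(|A|-1)-3\binom{2}{2}+1=2|A|-4$$ if and only if one of the following (i)–(v) holds. (i) $A=\{c,\pm d\}$ for some $c\in\mathbb{Z}$ and $d\in\mathbb{Z}^+$ with $|c|\neq d$. (ii) $A=\{\pm c,\pm d\}$ for some $c,d\in\mathbb{Z}^+$ with $c\neq d$. (iii) $A=\{\pm d\}\cup\{c\pm d\}$ for some $c\in\mathbb{Z}$ and $d\in\mathbb{Z}^+$ with $c\neq 0,\pm 2d$. (iv) $A=\{rd:\ s\le r\le t\}$ for some integers $d\neq 0$, $s\le -1$ and $t\ge 1$ with $t-s\ge 4$. (v) $A=\{(2r-1)d:\ s\le r\le t\}$ for some integers $d\neq 0$, $s\le 0$ and $t\ge 1$ with $t-s\ge 4$.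
   Context: For a finite set $A\subseteq\mathbb{Z}$ and a positive integer $n$, define the restricted sumset $$S_n(A)=\{a_1+\cdots+a_n:\ a_1,\ldots,a_n\in A,\ \text{and}\ a_i^2\neq a_j^2\ \text{for}\ 1\le i<j\le n\}.$$ $\mathbb{Z}^+$ denotes the set of positive integers; $\{\pm d\}$ means $\{d,-d\}$ and $\{c\pm d\}$ means $\{c+d,c-d\}$. -}

module Defs where

open import Data.Integer using (ℤ; +_; -_; _+_; _-_; _*_; _≤_; _<_; _≟_)
open import Data.List using (List; []; _∷_; concatMap; deduplicate)
open import Data.List.Membership.Propositional using (_∈_)
open import Data.Product using (∃; _×_; Σ)
open import Data.Sum using (_⊎_)
open import Relation.Binary.PropositionalEquality using (_≡_; _≢_)
open import Relation.Nullary using (yes; no)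
open import Function.Bundles using (_⇔_)

-- A finite set of integers is represented by a duplicate-free list (Unique),
-- its cardinality being the length of the list.

pairSums : List ℤ → List ℤ
pairSums A = concatMap (λ a → concatMap (λ b → keep a b) A) A
  where
  keep : ℤ → ℤ → List ℤ
  keep a b with a * a ≟ b * b
  ... | yes _ = []
  ... | no  _ = (a + b) ∷ []

S₂ : List ℤ → List ℤ
S₂ A = deduplicate _≟_ (pairSums A)

_≐_ : List ℤ → (ℤ → Set) → Set
A ≐ P = ∀ x → (x ∈ A) ⇔ P x

CaseI : List ℤ → Set
CaseI A = ∃ λ c → ∃ λ d → (+ 0 < d) × (Data.Integer.∣ c ∣ ≢ Data.Integer.∣ d ∣) ×
  (A ≐ λ x → x ≡ c ⊎ x ≡ d ⊎ x ≡ - d)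

CaseII : List ℤ → Set
CaseII A = ∃ λ c → ∃ λ d → (+ 0 < c) × (+ 0 < d) × (c ≢ d) ×
  (A ≐ λ x → x ≡ c ⊎ x ≡ - c ⊎ x ≡ d ⊎ x ≡ - d)

CaseIII : List ℤ → Set
CaseIII A = ∃ λ c → ∃ λ d → (+ 0 < d) × (c ≢ + 0) × (c ≢ + 2 * d) × (c ≢ - (+ 2 * d)) ×
  (A ≐ λ x → x ≡ d ⊎ x ≡ - d ⊎ x ≡ c + d ⊎ x ≡ c - d)

CaseIV : List ℤ → Set
CaseIV A = ∃ λ d → ∃ λ s → ∃ λ t → (d ≢ + 0) × (s ≤ - (+ 1)) × (+ 1 ≤ t) × (+ 4 ≤ t - s) ×
  (A ≐ λ x → ∃ λ r → (s ≤ r) × (r ≤ t) × (x ≡ r * d))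

CaseV : List ℤ → Set
CaseV A = ∃ λ d → ∃ λ s → ∃ λ t → (d ≢ + 0) × (s ≤ + 0) × (+ 1 ≤ t) × (+ 4 ≤ t - s) ×
  (A ≐ λ x → ∃ λ r → (s ≤ r) × (r ≤ t) × (x ≡ (+ 2 * r - + 1) * d))

-- Sort A as f 0 < f 1 < ⋯ < f (n - 1). The 2n - 3 border sums f 0 + f k and f k + f (n - 1) of
-- the addition table are distinct sums of two distinct elements, and S₂(A) consists exactly of
-- the nonzero such sums; so |S₂(A)| ≥ 2n - 4, with equality iff every pair sum lies on the border
-- and 0 is one of them. In that case f 1 + f j is squeezed between border entries, which forces
-- f 1 + f j = f 0 + f (j + 1), and similarly f 2 + f (n - 2) = f 1 + f (n - 1); for n ≥ 5 this
-- makes A an arithmetic progression, and the parity of i + j in the zero sum f i + f j = 0 decides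
-- between (iv) and (v). For n = 3 and n = 4 the position of the zero sum (and f 1 + f 2 = f 0 + f 3
-- when n = 4) gives (i)–(iii). Conversely, in each case an explicit list of at most 2n - 3 values,
-- one of them 0, contains all sums of two distinct elements.
module Submission where

open import Defs
open import Data.Integer as ℤ using (ℤ; +_; -[1+_]; -_; _+_; _-_; _*_; 0ℤ)
import Data.Integer.Properties as ℤ
open import Algebra.Properties.AbelianGroup ℤ.+-0-abelianGroup
  using (inverseˡ-unique; inverseʳ-unique; ∙-cancelˡ; ∙-cancelʳ)
open import Data.Integer.Tactic.RingSolver using (solve-∀)
open import Data.List using (List; []; _∷_; length; map; filter; applyUpTo; concatMap; _++_)
open import Data.List.Membership.Propositional using (_∈_; find)
open import Data.List.Membership.Propositional.Properties
  using (∈-filter⁺; ∈-++⁻; ∈-map⁺; ∈-applyUpTo⁺; ∈-applyUpTo⁻; ∈-concatMap⁺; ∈-concatMap⁻;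
         ∈-deduplicate⁺; ∈-deduplicate⁻)
open import Data.List.Properties using (filter-notAll; length-applyUpTo; length-++; length-map)
open import Data.List.Relation.Binary.Permutation.Propositional
  using (_↭_; prep; swap; ↭-refl; ↭-sym; ↭-trans; ↭-reflexive; ↭⇒↭ₛ)
open import Data.List.Relation.Binary.Permutation.Propositional.Properties
  using (↭-length; ∈-resp-↭; ↭-reverse)
import Data.List.Relation.Binary.Permutation.Setoid.Properties as ↭ₛ
open import Data.List.Relation.Binary.Subset.Propositional using (_⊆_)
open import Data.List.Relation.Unary.All as All using ([]; _∷_)
open import Data.List.Relation.Unary.All.Properties using (¬Any⇒All¬)
open import Data.List.Relation.Unary.Any as Any using (here; there)
open import Data.List.Relation.Unary.Linked using (Linked; []; [-]; _∷_)
open import Data.List.Relation.Unary.Unique.Propositional using (Unique; []; _∷_)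
open import Data.List.Relation.Unary.Unique.Propositional.Properties using (++⁺; applyUpTo⁺₁)
open import Data.List.Relation.Unary.Unique.DecPropositional.Properties ℤ._≟_ using (deduplicate-!)
open import Data.List.Sort ℤ.≤-decTotalOrder using (sort; sort-↗; sort-↭)
open import Data.Nat as ℕ using (ℕ; zero; suc; z≤n; s≤s)
import Data.Nat.Properties as ℕ
open import Data.Nat.Tactic.RingSolver using () renaming (solve-∀ to ℕ-solve-∀)
open import Data.Product using (∃; ∃₂; _×_; _,_; proj₁; proj₂)
open import Data.Sum as Sum using (_⊎_; inj₁; inj₂; [_,_])
open import Function using (_∘_)
open import Function.Bundles using (_⇔_; mk⇔; Equivalence)
open import Relation.Binary.Core using (_Preserves_⟶_)
open import Relation.Binary.Definitions using (DecidableEquality; tri<; tri≈; tri>)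
open import Relation.Binary.PropositionalEquality
  using (_≡_; _≢_; refl; sym; trans; cong; cong₂; subst; subst₂; setoid; module ≡-Reasoning)
open import Relation.Nullary using (¬_; yes; no; ¬?; contradiction)

module _ {a} {X : Set a} where

  Unique-resp-↭ : ∀ {xs ys : List X} → xs ↭ ys → Unique xs → Unique ys
  Unique-resp-↭ xs↭ys = ↭ₛ.Unique-resp-↭ (setoid X) (↭⇒↭ₛ xs↭ys)

  module _ (_≟_ : DecidableEquality X) where

    open import Data.List.Membership.DecPropositional _≟_ using (_∈?_)

    Unique-⊆⇒length≤ : ∀ {xs ys : List X} → Unique xs → xs ⊆ ys → length xs ℕ.≤ length ys
    Unique-⊆⇒length≤ [] _ = z≤n
    Unique-⊆⇒length≤ {x ∷ xs} {ys} (x∉xs ∷ !xs) x∷xs⊆ys = ℕ.≤-trans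
      (s≤s (Unique-⊆⇒length≤ !xs xs⊆ys-x))
      (filter-notAll (λ y → ¬? (y ≟ x)) ys (Any.map (λ x≡y y≢x → y≢x (sym x≡y)) (x∷xs⊆ys (here refl))))
      where
      xs⊆ys-x : xs ⊆ filter (λ y → ¬? (y ≟ x)) ys
      xs⊆ys-x z∈xs = ∈-filter⁺ _ (x∷xs⊆ys (there z∈xs)) (λ z≡x → All.lookup x∉xs z∈xs (sym z≡x))

    ⊆-length⇒⊇ : ∀ {xs ys : List X} → Unique xs → xs ⊆ ys → length ys ℕ.≤ length xs → ys ⊆ xs
    ⊆-length⇒⊇ {xs} {ys} !xs xs⊆ys |ys|≤|xs| {y} y∈ys with y ∈? xs
    ... | yes y∈xs = y∈xs
    ... | no y∉xs = contradiction
      (ℕ.≤-trans (Unique-⊆⇒length≤ (¬Any⇒All¬ xs y∉xs ∷ !xs) y∷xs⊆ys) |ys|≤|xs|) (ℕ.<-irrefl refl)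
      where
      y∷xs⊆ys : y ∷ xs ⊆ ys
      y∷xs⊆ys (here refl) = y∈ys
      y∷xs⊆ys (there z∈xs) = xs⊆ys z∈xs

+-cancelˡ-< : ∀ x {y z} → x + y ℤ.< x + z → y ℤ.< z
+-cancelˡ-< x {y} {z} x+y<x+z with y ℤ.<? z
... | yes y<z = y<z
... | no y≮z = contradiction x+y<x+z (ℤ.≤⇒≯ (ℤ.+-monoʳ-≤ x (ℤ.≮⇒≥ y≮z)))

+-cancelˡ-≤ : ∀ x {y z} → x + y ℤ.≤ x + z → y ℤ.≤ z
+-cancelˡ-≤ x {y} {z} x+y≤x+z with y ℤ.≤? z
... | yes y≤z = y≤z
... | no y≰z = contradiction x+y≤x+z (ℤ.<⇒≱ (ℤ.+-monoʳ-< x (ℤ.≰⇒> y≰z)))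

offset : ∀ {a x} → a ℤ.≤ x → ∃ λ k → x ≡ a + + k
offset {a} {x} a≤x = ℤ.∣ x - a ∣ , (begin
  x                 ≡⟨ split a x ⟩
  a + (x - a)       ≡⟨ cong (_+_ a) (ℤ.0≤i⇒+∣i∣≡i (ℤ.i≤j⇒0≤j-i a≤x)) ⟨
  a + + ℤ.∣ x - a ∣ ∎)
  where
  open ≡-Reasoning
  split : ∀ a x → x ≡ a + (x - a)
  split = solve-∀

interval : ℤ → ℕ → List ℤ
interval a n = applyUpTo (λ k → a + + k) n

∈-interval⁺ : ∀ {a x n} → a ℤ.≤ x → x ℤ.< a + + n → x ∈ interval a n
∈-interval⁺ {a} a≤x x<a+n with offset a≤x
... | k , refl = ∈-applyUpTo⁺ (λ k → a + + k) (ℤ.drop‿+<+ (+-cancelˡ-< a x<a+n))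

reindex : ∀ {s N} (P : ℤ → Set) →
  (∃ λ k → k ℕ.≤ N × P (s + + k)) ⇔ (∃ λ r → s ℤ.≤ r × r ℤ.≤ s + + N × P r)
reindex {s} {N} P = mk⇔
  (λ (k , k≤N , p) → s + + k , ℤ.i≤i+j s (+ k) , ℤ.+-monoʳ-≤ s (ℤ.+≤+ k≤N) , p)
  (λ (r , s≤r , r≤s+N , p) → from (offset s≤r) r≤s+N p)
  where
  from : ∀ {r} → (∃ λ k → r ≡ s + + k) → r ℤ.≤ s + + N → P r → ∃ λ k → k ℕ.≤ N × P (s + + k)
  from (k , refl) s+k≤s+N p = k , ℤ.drop‿+≤+ (+-cancelˡ-≤ s s+k≤s+N) , p

offset-suc : ∀ {s t} → + 1 ℤ.≤ t - s → ∃ λ K → t ≡ s + + suc K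
offset-suc {s} {t} 1≤t-s with offset 1≤t-s
... | K , t-s≡1+K = K , (begin
  t           ≡⟨ split s t ⟩
  s + (t - s) ≡⟨ cong (_+_ s) t-s≡1+K ⟩
  s + + suc K ∎)
  where
  open ≡-Reasoning
  split : ∀ s t → t ≡ s + (t - s)
  split = solve-∀

distinct-sum-bounds : ∀ {s t r r′} → s ℤ.≤ r → r ℤ.≤ t → s ℤ.≤ r′ → r′ ℤ.≤ t → r ≢ r′ →
  s + s ℤ.< r + r′ × r + r′ ℤ.< t + t
distinct-sum-bounds {r = r} {r′} s≤r r≤t s≤r′ r′≤t r≢r′ with ℤ.<-cmp r r′
... | tri< r<r′ _ _ = ℤ.+-mono-≤-< s≤r (ℤ.≤-<-trans s≤r r<r′) , ℤ.+-mono-<-≤ (ℤ.<-≤-trans r<r′ r′≤t) r′≤t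
... | tri≈ _ r≡r′ _ = contradiction r≡r′ r≢r′
... | tri> _ _ r′<r = ℤ.+-mono-<-≤ (ℤ.≤-<-trans s≤r′ r′<r) s≤r′ , ℤ.+-mono-≤-< r≤t (ℤ.<-≤-trans r′<r r≤t)

squares-differ : ∀ {a b} → a ≢ b → a + b ≢ 0ℤ → a * a ≢ b * b
squares-differ {a} {b} a≢b a+b≢0 a²≡b² with ℤ.i*j≡0⇒i≡0∨j≡0 (a - b) (begin
    (a - b) * (a + b) ≡⟨ difference-of-squares a b ⟩
    a * a - b * b     ≡⟨ ℤ.i≡j⇒i-j≡0 a²≡b² ⟩
    0ℤ                ∎)
  where
  open ≡-Reasoning
  difference-of-squares : ∀ a b → (a - b) * (a + b) ≡ a * a - b * b
  difference-of-squares = solve-∀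
... | inj₁ a-b≡0 = a≢b (ℤ.i-j≡0⇒i≡j a b a-b≡0)
... | inj₂ a+b≡0 = a+b≢0 a+b≡0

squares-differ⇒sum≢0 : ∀ {a b} → a * a ≢ b * b → a + b ≢ 0ℤ
squares-differ⇒sum≢0 {a} {b} a²≢b² a+b≡0 = a²≢b² (begin
  a * a     ≡⟨ neg-square a ⟨
  - a * - a ≡⟨ cong (λ c → c * c) (inverseʳ-unique a b a+b≡0) ⟨
  b * b     ∎)
  where
  open ≡-Reasoning
  neg-square : ∀ a → - a * - a ≡ a * a
  neg-square = solve-∀

x+x≡0⇒x≡0 : ∀ {x} → x + x ≡ 0ℤ → x ≡ 0ℤ
x+x≡0⇒x≡0 {x} x+x≡0 with ℤ.i*j≡0⇒i≡0∨j≡0 (+ 2) (trans (double x) x+x≡0)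
  where
  double : ∀ x → + 2 * x ≡ x + x
  double = solve-∀
... | inj₂ x≡0 = x≡0

<∧+≡0⇒0< : ∀ {x y} → x ℤ.< y → x + y ≡ 0ℤ → 0ℤ ℤ.< y
<∧+≡0⇒0< {x} {y} x<y x+y≡0 with 0ℤ ℤ.<? y
... | yes 0<y = 0<y
... | no 0≮y = contradiction x+y≡0 (ℤ.<⇒≢ (ℤ.+-mono-<-≤ (ℤ.<-≤-trans x<y y≤0) y≤0))
  where
  y≤0 : y ℤ.≤ 0ℤ
  y≤0 = ℤ.≮⇒≥ 0≮y

pos≢neg : ∀ {x y} → 0ℤ ℤ.< x → 0ℤ ℤ.< y → x ≢ - y
pos≢neg 0<x 0<y x≡-y = ℤ.<-asym 0<x (subst (ℤ._< 0ℤ) (sym x≡-y) (ℤ.neg-mono-< 0<y))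

∣∣≡∣∣⇒≡⊎≡- : ∀ c {d} → 0ℤ ℤ.≤ d → ℤ.∣ c ∣ ≡ ℤ.∣ d ∣ → c ≡ d ⊎ c ≡ - d
∣∣≡∣∣⇒≡⊎≡- (+ _) (ℤ.+≤+ _) refl = inj₁ refl
∣∣≡∣∣⇒≡⊎≡- -[1+ _ ] (ℤ.+≤+ _) refl = inj₂ refl

sums⇒gaps : ∀ a b x y → a + x ≡ b + y → y - x ≡ a - b
sums⇒gaps a b x y a+x≡b+y = begin
  y - x             ≡⟨ add-left b x y ⟩
  (b + y) - (b + x) ≡⟨ cong (_- (b + x)) a+x≡b+y ⟨
  (a + x) - (b + x) ≡⟨ add-right a b x ⟨
  a - b             ∎
  where
  open ≡-Reasoning
  add-left : ∀ b x y → y - x ≡ (b + y) - (b + x)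
  add-left = solve-∀
  add-right : ∀ a b x → a - b ≡ (a + x) - (b + x)
  add-right = solve-∀

parity : ∀ n → ∃ λ q → n ≡ q ℕ.+ q ⊎ n ≡ suc (q ℕ.+ q)
parity zero = 0 , inj₁ refl
parity (suc n) with parity n
... | q , inj₁ n≡2q = q , inj₂ (cong suc n≡2q)
... | q , inj₂ n≡2q+1 = suc q , inj₁ (cong suc (trans n≡2q+1 (sym (ℕ.+-suc q q))))

q+q<N+N⇒q<N : ∀ {q N} → q ℕ.+ q ℕ.< N ℕ.+ N → q ℕ.< N
q+q<N+N⇒q<N {q} {N} 2q<2N with q ℕ.<? N
... | yes q<N = q<N
... | no q≮N = contradiction 2q<2N (ℕ.≤⇒≯ (ℕ.+-mono-≤ (ℕ.≮⇒≥ q≮N) (ℕ.≮⇒≥ q≮N)))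

half-sum-positive : ∀ {i j} q → i ℕ.< j → i ℕ.+ j ≡ q ℕ.+ q → 1 ℕ.≤ q
half-sum-positive (suc _) _ _ = s≤s z≤n
half-sum-positive {i} zero i<j i+j≡0 =
  contradiction (ℕ.m+n≡0⇒n≡0 i i+j≡0) (ℕ.n>0⇒n≢0 (ℕ.≤-<-trans z≤n i<j))

2*[2+l]∸4≡l+l : ∀ l → 2 ℕ.* suc (suc l) ℕ.∸ 4 ≡ l ℕ.+ l
2*[2+l]∸4≡l+l l = trans (cong (ℕ._∸ 4) (expand l)) (ℕ.m+n∸m≡n 4 (l ℕ.+ l))
  where
  expand : ∀ l → 2 ℕ.* suc (suc l) ≡ 4 ℕ.+ (l ℕ.+ l)
  expand = ℕ-solve-∀

-- S₂(A) as the set of nonzero sums of two distinct elements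

DistinctSum : List ℤ → ℤ → Set
DistinctSum A x = ∃₂ λ a b → a ∈ A × b ∈ A × a ≢ b × x ≡ a + b

private
  -- The filter of pairSums is local to a where-block of Defs and has no name there;
  -- unifying pairSums A with its unfolding recovers it.
  localFilter : (A : List ℤ) (K : ℤ → ℤ → List ℤ) →
    pairSums A ≡ concatMap (λ a → concatMap (K a) A) A → ℤ → ℤ → List ℤ
  localFilter _ K _ = K

  keep : List ℤ → ℤ → ℤ → List ℤ
  keep A = localFilter A _ refl

  ∈-keep⁺ : ∀ A {a b} → a * a ≢ b * b → a + b ∈ keep A a b
  ∈-keep⁺ A {a} {b} a²≢b² with a * a ℤ.≟ b * b
  ... | yes a²≡b² = contradiction a²≡b² a²≢b²
  ... | no _ = here refl

  ∈-keep⁻ : ∀ A {a b x} → x ∈ keep A a b → a * a ≢ b * b × x ≡ a + b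
  ∈-keep⁻ A {a} {b} x∈ with a * a ℤ.≟ b * b | x∈
  ... | no a²≢b² | here x≡a+b = a²≢b² , x≡a+b

∈-S₂⁺ : ∀ {A x} → DistinctSum A x → x ≢ 0ℤ → x ∈ S₂ A
∈-S₂⁺ {A} (a , b , a∈A , b∈A , a≢b , refl) a+b≢0 = ∈-deduplicate⁺ ℤ._≟_ (∈-concatMap⁺ _
  (Any.map (λ { refl → ∈-concatMap⁺ _ (Any.map (λ { refl → ∈-keep⁺ A (squares-differ a≢b a+b≢0) }) b∈A) }) a∈A))

∈-S₂⁻ : ∀ {A x} → x ∈ S₂ A → DistinctSum A x × x ≢ 0ℤ
∈-S₂⁻ {A} x∈S₂ with find (∈-concatMap⁻ _ (∈-deduplicate⁻ ℤ._≟_ (pairSums A) x∈S₂))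
... | a , a∈A , x∈row with find (∈-concatMap⁻ (keep A a) {xs = A} x∈row)
... | b , b∈A , x∈keep with ∈-keep⁻ A x∈keep
... | a²≢b² , refl =
  (a , b , a∈A , b∈A , a²≢b² ∘ cong (λ c → c * c) , refl) , squares-differ⇒sum≢0 {a} {b} a²≢b²

0∷S₂-unique : ∀ A → Unique (0ℤ ∷ S₂ A)
0∷S₂-unique A = ¬Any⇒All¬ (S₂ A) (λ 0∈S₂ → proj₂ (∈-S₂⁻ {A} 0∈S₂) refl) ∷ deduplicate-! (pairSums A)

DistinctSum⇒∈0∷S₂ : ∀ {A x} → DistinctSum A x → x ∈ 0ℤ ∷ S₂ A
DistinctSum⇒∈0∷S₂ {x = x} sum with x ℤ.≟ 0ℤ
... | yes x≡0 = here x≡0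
... | no x≢0 = there (∈-S₂⁺ sum x≢0)

S₂-length< : ∀ {A L} → (∀ {x} → DistinctSum A x → x ∈ L) → 0ℤ ∈ L → length (S₂ A) ℕ.< length L
S₂-length< {A} sums⊆L 0∈L = Unique-⊆⇒length≤ ℤ._≟_ (0∷S₂-unique A) 0∷S₂⊆L
  where
  0∷S₂⊆L : 0ℤ ∷ S₂ A ⊆ _
  0∷S₂⊆L (here refl) = 0∈L
  0∷S₂⊆L (there x∈S₂) = sums⊆L (proj₁ (∈-S₂⁻ x∈S₂))

DistinctSums-length≤ : ∀ {A U} → Unique U → (∀ {x} → x ∈ U → DistinctSum A x) →
  length U ℕ.≤ suc (length (S₂ A))
DistinctSums-length≤ !U sums = Unique-⊆⇒length≤ ℤ._≟_ !U (DistinctSum⇒∈0∷S₂ ∘ sums)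

StrictlyIncreasing : (ℕ → ℤ) → Set
StrictlyIncreasing f = f Preserves ℕ._<_ ⟶ ℤ._<_

module _ {f : ℕ → ℤ} where

  stepwise⇒StrictlyIncreasing : (∀ k → f k ℤ.< f (suc k)) → StrictlyIncreasing f
  stepwise⇒StrictlyIncreasing step {i} {suc j} (s≤s i≤j) with ℕ.m≤n⇒m<n∨m≡n i≤j
  ... | inj₁ i<j = ℤ.<-trans (stepwise⇒StrictlyIncreasing step i<j) (step j)
  ... | inj₂ refl = step i

  module _ (f↑ : StrictlyIncreasing f) where

    StrictlyIncreasing⇒mono-≤ : ∀ {i j} → i ℕ.≤ j → f i ℤ.≤ f j
    StrictlyIncreasing⇒mono-≤ i≤j with ℕ.m≤n⇒m<n∨m≡n i≤j
    ... | inj₁ i<j = ℤ.<⇒≤ (f↑ i<j)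
    ... | inj₂ refl = ℤ.≤-refl

    StrictlyIncreasing⇒cancel-< : ∀ {i j} → f i ℤ.< f j → i ℕ.< j
    StrictlyIncreasing⇒cancel-< {i} {j} fi<fj with ℕ.<-cmp i j
    ... | tri< i<j _ _ = i<j
    ... | tri≈ _ refl _ = contradiction fi<fj (ℤ.<-irrefl refl)
    ... | tri> _ _ j<i = contradiction (f↑ j<i) (ℤ.<-asym fi<fj)

constant-gaps⇒progression : ∀ (f : ℕ → ℤ) {e} N → (∀ k → k ℕ.< N → f (suc k) - f k ≡ e) →
  ∀ k → k ℕ.≤ N → f k ≡ f 0 + + k * e
constant-gaps⇒progression f _ _ zero _ = sym (ℤ.+-identityʳ (f 0))
constant-gaps⇒progression f {e} N gaps (suc k) k<N = begin
  f (suc k)               ≡⟨ step (f k) (f (suc k)) ⟩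
  f k + (f (suc k) - f k) ≡⟨ cong₂ _+_ (constant-gaps⇒progression f N gaps k (ℕ.<⇒≤ k<N)) (gaps k k<N) ⟩
  (f 0 + + k * e) + e     ≡⟨ collect (f 0) (+ k) e ⟩
  f 0 + + suc k * e       ∎
  where
  open ≡-Reasoning
  step : ∀ x y → y ≡ x + (y - x)
  step = solve-∀
  collect : ∀ a k e → (a + k * e) + e ≡ a + (+ 1 + k) * e
  collect = solve-∀

-- The entries of x ∷ xs, continued past the end in steps of 1 so as to stay strictly increasing.
extend : ℤ → List ℤ → ℕ → ℤ
extend x xs zero = x
extend x [] (suc k) = ℤ.suc (extend x [] k)
extend x (y ∷ ys) (suc k) = extend y ys k

extend-step : ∀ {x xs} → Linked ℤ._<_ (x ∷ xs) → ∀ k → extend x xs k ℤ.< extend x xs (suc k)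
extend-step {xs = []} _ k = ℤ.suc[i]≤j⇒i<j ℤ.≤-refl
extend-step {xs = y ∷ ys} (x<y ∷ _) zero = x<y
extend-step {xs = y ∷ ys} (_ ∷ y∷ys↗) (suc k) = extend-step y∷ys↗ k

applyUpTo-extend : ∀ x xs → applyUpTo (extend x xs) (suc (length xs)) ≡ x ∷ xs
applyUpTo-extend x [] = refl
applyUpTo-extend x (y ∷ ys) = cong (x ∷_) (applyUpTo-extend y ys)

strictlySorted⇒enumeration : ∀ {B} → Linked ℤ._<_ B →
  ∃ λ f → StrictlyIncreasing f × applyUpTo f (length B) ≡ B
strictlySorted⇒enumeration {[]} _ = +_ , ℤ.+<+ , refl
strictlySorted⇒enumeration {x ∷ xs} B↗ =
  extend x xs , stepwise⇒StrictlyIncreasing (extend-step B↗) , applyUpTo-extend x xs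

sorted∧unique⇒strictlySorted : ∀ {B} → Linked ℤ._≤_ B → Unique B → Linked ℤ._<_ B
sorted∧unique⇒strictlySorted [] _ = []
sorted∧unique⇒strictlySorted [-] _ = [-]
sorted∧unique⇒strictlySorted (x≤y ∷ B↗) ((x≢y ∷ _) ∷ !B) =
  ℤ.≤∧≢⇒< x≤y x≢y ∷ sorted∧unique⇒strictlySorted B↗ !B

sortedEnumeration : ∀ {A} → Unique A → ∃ λ f → StrictlyIncreasing f × A ↭ applyUpTo f (length A)
sortedEnumeration {A} !A with strictlySorted⇒enumeration
    (sorted∧unique⇒strictlySorted (sort-↗ A) (Unique-resp-↭ (↭-sym (sort-↭ A)) !A))
... | f , f↑ , f≡sort = f , f↑ , ↭-trans (↭-sym (sort-↭ A))
  (↭-reflexive (trans (sym f≡sort) (cong (applyUpTo f) (↭-length (sort-↭ A)))))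

-- The border of the addition table of f 0 < f 1 < ⋯ < f (suc l)

module Border {f : ℕ → ℤ} (f↑ : StrictlyIncreasing f) (l : ℕ) where

  top : ℕ
  top = suc l

  f-mono-≤ : ∀ {i j} → i ℕ.≤ j → f i ℤ.≤ f j
  f-mono-≤ = StrictlyIncreasing⇒mono-≤ f↑

  f-cancel-< : ∀ {i j} → f i ℤ.< f j → i ℕ.< j
  f-cancel-< = StrictlyIncreasing⇒cancel-< f↑

  rowSum columnSum : ℕ → ℤ
  rowSum k = f 0 + f (suc k)
  columnSum k = f (suc k) + f top

  firstRow lastColumn border : List ℤ
  firstRow = applyUpTo rowSum top
  lastColumn = applyUpTo columnSum l
  border = firstRow ++ lastColumn

  length-border : length border ≡ suc (l ℕ.+ l)
  length-border = trans (length-++ firstRow)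
    (cong₂ ℕ._+_ (length-applyUpTo rowSum top) (length-applyUpTo columnSum l))

  ∈-border⁻ : ∀ {x} → x ∈ border →
    (∃ λ k → k ℕ.< top × x ≡ f 0 + f (suc k)) ⊎ (∃ λ k → k ℕ.< l × x ≡ f (suc k) + f top)
  ∈-border⁻ x∈ with ∈-++⁻ firstRow x∈
  ... | inj₁ x∈row = inj₁ (∈-applyUpTo⁻ rowSum x∈row)
  ... | inj₂ x∈column = inj₂ (∈-applyUpTo⁻ columnSum x∈column)

  border-unique : Unique border
  border-unique = ++⁺
    (applyUpTo⁺₁ rowSum top (λ i<j _ → ℤ.<⇒≢ (ℤ.+-monoʳ-< (f 0) (f↑ (s≤s i<j)))))
    (applyUpTo⁺₁ columnSum l (λ i<j _ → ℤ.<⇒≢ (ℤ.+-monoˡ-< (f top) (f↑ (s≤s i<j)))))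
    row∩column≡∅
    where
    row∩column≡∅ : ∀ {x} → ¬ (x ∈ firstRow × x ∈ lastColumn)
    row∩column≡∅ (x∈row , x∈column)
      with ∈-applyUpTo⁻ rowSum x∈row | ∈-applyUpTo⁻ columnSum x∈column
    ... | i , i<top , refl | j , _ , eq = ℤ.<⇒≢ (ℤ.≤-<-trans
      (ℤ.+-monoʳ-≤ (f 0) (f-mono-≤ i<top))
      (ℤ.+-monoˡ-< (f top) (f↑ (s≤s z≤n)))) eq

  border-sums : ∀ {x} → x ∈ border → ∃₂ λ i j → i ℕ.< j × j ℕ.≤ top × x ≡ f i + f j
  border-sums x∈ with ∈-border⁻ x∈
  ... | inj₁ (k , k<top , eq) = 0 , suc k , s≤s z≤n , k<top , eq
  ... | inj₂ (k , k<l , eq) = suc k , top , s≤s k<l , ℕ.≤-refl , eq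

  Saturated : Set
  Saturated = ∀ {i j} → i ℕ.< j → j ℕ.≤ top → f i + f j ∈ border

  module _ (saturated : Saturated) where

    row-position : ∀ {j} → 2 ℕ.≤ j → j ℕ.≤ l →
      ∃ λ k → j ℕ.≤ k × k ℕ.≤ l × f 1 + f j ≡ f 0 + f (suc k)
    row-position {j} 2≤j j≤l with ∈-border⁻ (saturated 2≤j (ℕ.m≤n⇒m≤1+n j≤l))
    ... | inj₁ (k , s≤s k≤l , eq) = k , j≤k , k≤l , eq
      where
      j≤k : j ℕ.≤ k
      j≤k = ℕ.≤-pred (f-cancel-< (+-cancelˡ-< (f 0)
        (subst (f 0 + f j ℤ.<_) eq (ℤ.+-monoˡ-< (f j) (f↑ (s≤s z≤n))))))
    ... | inj₂ (k , _ , eq) = contradiction eq (ℤ.<⇒≢ (ℤ.<-≤-trans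
      (ℤ.+-monoʳ-< (f 1) (f↑ (s≤s j≤l))) (ℤ.+-monoˡ-≤ (f top) (f-mono-≤ (s≤s z≤n)))))

    -- Downward induction on j = l ∸ g: the row position of f 1 + f j lies below that of
    -- f 1 + f (suc j), which is suc j by induction.
    shift-row′ : ∀ g {j} → g ℕ.+ j ≡ l → 2 ℕ.≤ j → f 1 + f j ≡ f 0 + f (suc j)
    shift-row′ zero refl 2≤j with row-position 2≤j ℕ.≤-refl
    ... | k , j≤k , k≤j , eq = trans eq (cong (λ i → f 0 + f (suc i)) (ℕ.≤-antisym k≤j j≤k))
    shift-row′ (suc g) {j} g+j≡l 2≤j with row-position 2≤j (subst (j ℕ.≤_) g+j≡l (ℕ.m≤n+m j (suc g)))
    ... | k , j≤k , _ , eq = trans eq (cong (λ i → f 0 + f (suc i)) (ℕ.≤-antisym k≤j j≤k))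
      where
      open ℤ.≤-Reasoning
      k≤j : k ℕ.≤ j
      k≤j = ℕ.≤-pred (ℕ.≤-pred (f-cancel-< (+-cancelˡ-< (f 0) (begin-strict
        f 0 + f (suc k)       ≡⟨ eq ⟨
        f 1 + f j             <⟨ ℤ.+-monoʳ-< (f 1) (f↑ ℕ.≤-refl) ⟩
        f 1 + f (suc j)       ≡⟨ shift-row′ g (trans (ℕ.+-suc g j) g+j≡l) (ℕ.m≤n⇒m≤1+n 2≤j) ⟩
        f 0 + f (suc (suc j)) ∎))))

    shift-row : ∀ {j} → 2 ℕ.≤ j → j ℕ.≤ l → f 1 + f j ≡ f 0 + f (suc j)
    shift-row {j} 2≤j j≤l = shift-row′ (l ℕ.∸ j) (ℕ.m∸n+n≡m j≤l) 2≤j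

    shift-corner : 2 ℕ.< l → f 2 + f l ≡ f 1 + f top
    shift-corner 2<l with ∈-border⁻ (saturated 2<l (ℕ.n≤1+n l))
    ... | inj₂ (zero , _ , eq) = eq
    ... | inj₂ (suc k , _ , eq) = contradiction eq (ℤ.<⇒≢ (ℤ.+-mono-≤-<
      (f-mono-≤ (s≤s (s≤s z≤n))) (f↑ (ℕ.n<1+n l))))
    ... | inj₁ (k , k<top , eq) = contradiction (sym eq) (ℤ.<⇒≢ (begin-strict
        f 0 + f (suc k) ≤⟨ ℤ.+-monoʳ-≤ (f 0) (f-mono-≤ k<top) ⟩
        f 0 + f top     ≡⟨ shift-row (ℕ.<⇒≤ 2<l) ℕ.≤-refl ⟨
        f 1 + f l       <⟨ ℤ.+-monoˡ-< (f l) (f↑ ℕ.≤-refl) ⟩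
        f 2 + f l       ∎))
      where open ℤ.≤-Reasoning

    gaps-constant : 2 ℕ.< l → ∀ k → k ℕ.< top → f (suc k) - f k ≡ f 1 - f 0
    gaps-constant _ zero _ = refl
    gaps-constant 2<l (suc zero) _ = begin
      f 2 - f 1   ≡⟨ sums⇒gaps (f 2) (f 1) (f l) (f top) (shift-corner 2<l) ⟨
      f top - f l ≡⟨ sums⇒gaps (f 1) (f 0) (f l) (f top) (shift-row (ℕ.<⇒≤ 2<l) ℕ.≤-refl) ⟩
      f 1 - f 0   ∎
      where open ≡-Reasoning
    gaps-constant _ k@(suc (suc _)) (s≤s k≤l) =
      sums⇒gaps (f 1) (f 0) (f k) (f (suc k)) (shift-row (s≤s (s≤s z≤n)) k≤l)

    progression : 2 ℕ.< l → ∀ k → k ℕ.≤ top → f k ≡ f 0 + + k * (f 1 - f 0)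
    progression 2<l = constant-gaps⇒progression f top (gaps-constant 2<l)

module Enumerated {A : List ℤ} {f : ℕ → ℤ} (f↑ : StrictlyIncreasing f) (l : ℕ)
                  (A↭ : A ↭ applyUpTo f (suc (suc l))) where

  open Border f↑ l public

  f∈A : ∀ {i} → i ℕ.≤ top → f i ∈ A
  f∈A i≤top = ∈-resp-↭ (↭-sym A↭) (∈-applyUpTo⁺ f (s≤s i≤top))

  pair-DistinctSum : ∀ {i j} → i ℕ.< j → j ℕ.≤ top → DistinctSum A (f i + f j)
  pair-DistinctSum i<j j≤top =
    _ , _ , f∈A (ℕ.<⇒≤ (ℕ.<-≤-trans i<j j≤top)) , f∈A j≤top , ℤ.<⇒≢ (f↑ i<j) , refl

  border-DistinctSum : ∀ {x} → x ∈ border → DistinctSum A x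
  border-DistinctSum x∈ with border-sums x∈
  ... | i , j , i<j , j≤top , refl = pair-DistinctSum i<j j≤top

  S₂-length≥ : l ℕ.+ l ℕ.≤ length (S₂ A)
  S₂-length≥ = ℕ.≤-pred (subst (ℕ._≤ suc (length (S₂ A))) length-border
    (DistinctSums-length≤ border-unique border-DistinctSum))

  module Extremal (S₂-length≡ : length (S₂ A) ≡ l ℕ.+ l) where

    0∷S₂⊆border : 0ℤ ∷ S₂ A ⊆ border
    0∷S₂⊆border = ⊆-length⇒⊇ ℤ._≟_ border-unique (DistinctSum⇒∈0∷S₂ ∘ border-DistinctSum)
      (ℕ.≤-reflexive (trans (cong suc S₂-length≡) (sym length-border)))

    saturated : Saturated
    saturated i<j j≤top = 0∷S₂⊆border (DistinctSum⇒∈0∷S₂ (pair-DistinctSum i<j j≤top))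

    zero-pair : ∃₂ λ i j → i ℕ.< j × j ℕ.≤ top × f i + f j ≡ 0ℤ
    zero-pair with border-sums (0∷S₂⊆border (here refl))
    ... | i , j , i<j , j≤top , 0≡fi+fj = i , j , i<j , j≤top , sym 0≡fi+fj

-- Extremal sets are of type (i)–(v)

∈-triple : ∀ {x a b c : ℤ} → x ∈ a ∷ b ∷ c ∷ [] ⇔ (x ≡ a ⊎ x ≡ b ⊎ x ≡ c)
∈-triple = mk⇔
  (λ { (here p) → inj₁ p ; (there (here p)) → inj₂ (inj₁ p) ; (there (there (here p))) → inj₂ (inj₂ p) })
  (λ { (inj₁ p) → here p ; (inj₂ (inj₁ p)) → there (here p) ; (inj₂ (inj₂ p)) → there (there (here p)) })

∈-quadruple : ∀ {x a b c d : ℤ} → x ∈ a ∷ b ∷ c ∷ d ∷ [] ⇔ (x ≡ a ⊎ x ≡ b ⊎ x ≡ c ⊎ x ≡ d)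
∈-quadruple = mk⇔
  (λ { (here p) → inj₁ p ; (there (here p)) → inj₂ (inj₁ p) ; (there (there (here p))) → inj₂ (inj₂ (inj₁ p))
     ; (there (there (there (here p)))) → inj₂ (inj₂ (inj₂ p)) })
  (λ { (inj₁ p) → here p ; (inj₂ (inj₁ p)) → there (here p) ; (inj₂ (inj₂ (inj₁ p))) → there (there (here p))
     ; (inj₂ (inj₂ (inj₂ p))) → there (there (there (here p))) })

↭⇒≐ : ∀ {A xs} {P : ℤ → Set} → A ↭ xs → (∀ {x} → x ∈ xs ⇔ P x) → A ≐ P
↭⇒≐ A↭xs ∈xs⇔P _ =
  mk⇔ (Equivalence.to ∈xs⇔P ∘ ∈-resp-↭ A↭xs) (∈-resp-↭ (↭-sym A↭xs) ∘ Equivalence.from ∈xs⇔P)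

zeroPair⇒CaseI : ∀ {A c d e} → Unique A → A ↭ c ∷ d ∷ e ∷ [] → e ℤ.< d → e + d ≡ 0ℤ → CaseI A
zeroPair⇒CaseI {A} {c} {d} {e} !A A↭ e<d e+d≡0 =
  let c≢d , c≢-d = distinct in
  c , d , 0<d , [ c≢d , c≢-d ] ∘ ∣∣≡∣∣⇒≡⊎≡- c (ℤ.<⇒≤ 0<d) , ↭⇒≐ A↭′ ∈-triple
  where
  0<d = <∧+≡0⇒0< e<d e+d≡0
  A↭′ : A ↭ c ∷ d ∷ - d ∷ []
  A↭′ = subst (λ z → A ↭ c ∷ d ∷ z ∷ []) (inverseˡ-unique e d e+d≡0) A↭
  distinct : c ≢ d × c ≢ - d
  distinct with Unique-resp-↭ A↭′ !A
  ... | (c≢d ∷ c≢-d ∷ []) ∷ _ = c≢d , c≢-d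

zeroPairs⇒CaseII : ∀ {A a b c d} → A ↭ a ∷ b ∷ c ∷ d ∷ [] → b ℤ.< c → c ℤ.< d →
  a + d ≡ 0ℤ → b + c ≡ 0ℤ → CaseII A
zeroPairs⇒CaseII {A} {a} {b} {c} {d} A↭ b<c c<d a+d≡0 b+c≡0 =
  d , c , ℤ.<-trans 0<c c<d , 0<c , ℤ.<⇒≢ c<d ∘ sym , ↭⇒≐ A↭′ ∈-quadruple
  where
  0<c = <∧+≡0⇒0< b<c b+c≡0
  A↭′ : A ↭ d ∷ - d ∷ c ∷ - c ∷ []
  A↭′ = ↭-trans A↭ (subst₂ (λ x y → a ∷ b ∷ c ∷ d ∷ [] ↭ d ∷ x ∷ c ∷ y ∷ [])
    (inverseˡ-unique a d a+d≡0) (inverseˡ-unique b c b+c≡0)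
    (↭-trans (prep a (↭-trans (prep b (swap c d ↭-refl)) (swap b d ↭-refl)))
             (↭-trans (swap a d ↭-refl) (prep d (prep a (swap b c ↭-refl))))))

zeroPair⇒CaseIII : ∀ {A a b c d} → Unique A → A ↭ a ∷ b ∷ c ∷ d ∷ [] → a ℤ.< b →
  a + b ≡ 0ℤ → a + c ≡ b + d → CaseIII A
zeroPair⇒CaseIII {A} {a} {b} {c} {d} !A A↭ a<b a+b≡0 a+c≡b+d =
  let b≢[d+b]+b , b≢[d+b]-b , -b≢[d+b]+b = distinct in
  d + b , b , <∧+≡0⇒0< a<b a+b≡0 ,
  b≢[d+b]+b ∘ centre≡0 , b≢[d+b]-b ∘ centre≡2b , -b≢[d+b]+b ∘ centre≡-2b , ↭⇒≐ A↭′ ∈-quadruple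
  where
  open ≡-Reasoning
  c≡[d+b]+b : c ≡ (d + b) + b
  c≡[d+b]+b = begin
    c                       ≡⟨ isolate a b c ⟩
    ((a + c) + b) - (a + b) ≡⟨ cong₂ (λ x y → (x + b) - y) a+c≡b+d a+b≡0 ⟩
    ((b + d) + b) - 0ℤ      ≡⟨ reorder b d ⟩
    (d + b) + b             ∎
    where
    isolate : ∀ a b c → c ≡ ((a + c) + b) - (a + b)
    isolate = solve-∀
    reorder : ∀ b d → ((b + d) + b) - 0ℤ ≡ (d + b) + b
    reorder = solve-∀
  d≡[d+b]-b : ∀ d b → d ≡ (d + b) - b
  d≡[d+b]-b = solve-∀
  A↭′ : A ↭ b ∷ - b ∷ (d + b) + b ∷ (d + b) - b ∷ []
  A↭′ = ↭-trans A↭ (subst (λ x → a ∷ b ∷ c ∷ d ∷ [] ↭ b ∷ x ∷ (d + b) + b ∷ (d + b) - b ∷ [])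
    (inverseˡ-unique a b a+b≡0)
    (subst₂ (λ x y → a ∷ b ∷ c ∷ d ∷ [] ↭ b ∷ a ∷ x ∷ y ∷ []) c≡[d+b]+b (d≡[d+b]-b d b) (swap a b ↭-refl)))
  distinct : b ≢ (d + b) + b × b ≢ (d + b) - b × - b ≢ (d + b) + b
  distinct with Unique-resp-↭ A↭′ !A
  ... | (_ ∷ p ∷ q ∷ []) ∷ (r ∷ _) ∷ _ = p , q , r
  centre≡0 : d + b ≡ 0ℤ → b ≡ (d + b) + b
  centre≡0 c≡0 = sym (trans (cong (_+ b) c≡0) (ℤ.+-identityˡ b))
  centre≡2b : d + b ≡ + 2 * b → b ≡ (d + b) - b
  centre≡2b c≡2b = sym (trans (cong (_- b) c≡2b) (twice-minus b))
    where
    twice-minus : ∀ b → + 2 * b - b ≡ b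
    twice-minus = solve-∀
  centre≡-2b : d + b ≡ - (+ 2 * b) → - b ≡ (d + b) + b
  centre≡-2b c≡-2b = sym (trans (cong (_+ b) c≡-2b) (neg-twice-plus b))
    where
    neg-twice-plus : ∀ b → - (+ 2 * b) + b ≡ - b
    neg-twice-plus = solve-∀

module Progression {A : List ℤ} (a e : ℤ) (N : ℕ) (e≢0 : e ≢ 0ℤ) (4≤N : 4 ℕ.≤ N)
  (A≐ : A ≐ λ x → ∃ λ k → k ℕ.≤ N × x ≡ a + + k * e) where

  A≐image : ∀ (g : ℤ → ℤ) s → (∀ k → a + + k * e ≡ g (s + + k)) →
    A ≐ (λ x → ∃ λ r → s ℤ.≤ r × r ℤ.≤ s + + N × x ≡ g r)
  A≐image g s a+ke≡g x = mk⇔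
    (Equivalence.to (reindex (λ r → x ≡ g r)) ∘ (λ (k , k≤N , x≡) → k , k≤N , trans x≡ (a+ke≡g k))
      ∘ Equivalence.to (A≐ x))
    (Equivalence.from (A≐ x) ∘ (λ (k , k≤N , x≡) → k , k≤N , trans x≡ (sym (a+ke≡g k)))
      ∘ Equivalence.from (reindex (λ r → x ≡ g r)))

  recentre : ∀ q k → a + + k * e ≡ (a + + q * e) + (- + q + + k) * e
  recentre q k = shift a e (+ q) (+ k)
    where
    shift : ∀ a e q k → a + k * e ≡ (a + q * e) + (- q + k) * e
    shift = solve-∀

  centred-bounds : ∀ {q} → q ℕ.< N → + 1 ℤ.≤ - + q + + N × + 4 ℤ.≤ (- + q + + N) - - + q
  centred-bounds {q} q<N =
    subst (ℤ._≤ - + q + + N) (cancel (+ q)) (ℤ.+-monoʳ-≤ (- + q) (ℤ.+≤+ q<N)) ,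
    subst (+ 4 ℤ.≤_) (width (+ q) (+ N)) (ℤ.+≤+ 4≤N)
    where
    cancel : ∀ q → - q + (+ 1 + q) ≡ + 1
    cancel = solve-∀
    width : ∀ q N → N ≡ (- q + N) - - q
    width = solve-∀

  centre≡0⇒CaseIV : ∀ {q} → 1 ℕ.≤ q → q ℕ.< N → a + + q * e ≡ 0ℤ → CaseIV A
  centre≡0⇒CaseIV {q} 1≤q q<N centre≡0 = let 1≤t , 4≤t-s = centred-bounds q<N in
    e , - + q , - + q + + N , e≢0 , ℤ.neg-mono-≤ (ℤ.+≤+ 1≤q) , 1≤t , 4≤t-s ,
    A≐image (_* e) (- + q) (λ k → trans (recentre q k) (trans (cong (_+ _) centre≡0) (ℤ.+-identityˡ _)))

  centre-odd⇒CaseV : ∀ {q} → q ℕ.< N → (a + + q * e) + (a + + q * e) + e ≡ 0ℤ → CaseV A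
  centre-odd⇒CaseV {q} q<N 2centre+e≡0 = let 1≤t , 4≤t-s = centred-bounds q<N in
    d , - + q , - + q + + N , d≢0 , ℤ.neg-mono-≤ (ℤ.+≤+ z≤n) , 1≤t , 4≤t-s ,
    A≐image (λ r → (+ 2 * r - + 1) * d) (- + q) values
    where
    open ≡-Reasoning
    centre = a + + q * e
    d = - centre
    e≡2d : e ≡ + 2 * d
    e≡2d = trans (inverseʳ-unique (centre + centre) e 2centre+e≡0) (negate centre)
      where
      negate : ∀ u → - (u + u) ≡ + 2 * - u
      negate = solve-∀
    d≢0 : d ≢ 0ℤ
    d≢0 d≡0 = e≢0 (trans e≡2d (cong (+ 2 *_) d≡0))
    values : ∀ k → a + + k * e ≡ (+ 2 * (- + q + + k) - + 1) * d
    values k = begin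
      a + + k * e                        ≡⟨ recentre q k ⟩
      centre + (- + q + + k) * e         ≡⟨ cong (λ e → centre + (- + q + + k) * e) e≡2d ⟩
      centre + (- + q + + k) * (+ 2 * d) ≡⟨ odd-multiple centre (- + q + + k) ⟩
      (+ 2 * (- + q + + k) - + 1) * d    ∎
      where
      odd-multiple : ∀ u r → u + r * (+ 2 * - u) ≡ (+ 2 * r - + 1) * - u
      odd-multiple = solve-∀

  pair-sum : ∀ i j → (a + + i * e) + (a + + j * e) ≡ (a + a) + + (i ℕ.+ j) * e
  pair-sum i j = collect a e (+ i) (+ j)
    where
    collect : ∀ a e i j → (a + i * e) + (a + j * e) ≡ (a + a) + (i + j) * e
    collect = solve-∀

  -- The zero sum a + i e + a + j e = 0 centres A at (i + j) / 2: when i + j is even A contains 0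
  -- (case iv), otherwise A is symmetric about 0 without containing it (case v).
  zero-sum⇒CaseIV⊎CaseV : ∀ {i j} → i ℕ.< j → j ℕ.≤ N →
    (a + + i * e) + (a + + j * e) ≡ 0ℤ → CaseIV A ⊎ CaseV A
  zero-sum⇒CaseIV⊎CaseV {i} {j} i<j j≤N zero-sum with parity (i ℕ.+ j)
  ... | q , inj₁ i+j≡2q = inj₁ (centre≡0⇒CaseIV {q} (half-sum-positive q i<j i+j≡2q)
    (q+q<N+N⇒q<N (subst (ℕ._< N ℕ.+ N) i+j≡2q i+j<2N))
    (x+x≡0⇒x≡0 (begin
      (a + + q * e) + (a + + q * e) ≡⟨ pair-sum q q ⟩
      (a + a) + + (q ℕ.+ q) * e     ≡⟨ cong (λ n → (a + a) + + n * e) i+j≡2q ⟨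
      (a + a) + + (i ℕ.+ j) * e     ≡⟨ pair-sum i j ⟨
      (a + + i * e) + (a + + j * e) ≡⟨ zero-sum ⟩
      0ℤ                            ∎)))
    where
    open ≡-Reasoning
    i+j<2N : i ℕ.+ j ℕ.< N ℕ.+ N
    i+j<2N = ℕ.+-mono-<-≤ (ℕ.<-≤-trans i<j j≤N) j≤N
  ... | q , inj₂ i+j≡2q+1 = inj₂ (centre-odd⇒CaseV {q}
    (q+q<N+N⇒q<N (ℕ.<-trans (ℕ.n<1+n _) (subst (ℕ._< N ℕ.+ N) i+j≡2q+1 i+j<2N)))
    (begin
      (a + + q * e) + (a + + q * e) + e ≡⟨ collect a e (+ q) ⟩
      (a + a) + + suc (q ℕ.+ q) * e     ≡⟨ cong (λ n → (a + a) + + n * e) i+j≡2q+1 ⟨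
      (a + a) + + (i ℕ.+ j) * e         ≡⟨ pair-sum i j ⟨
      (a + + i * e) + (a + + j * e)     ≡⟨ zero-sum ⟩
      0ℤ                                ∎))
    where
    open ≡-Reasoning
    i+j<2N : i ℕ.+ j ℕ.< N ℕ.+ N
    i+j<2N = ℕ.+-mono-<-≤ (ℕ.<-≤-trans i<j j≤N) j≤N
    collect : ∀ a e q → ((a + q * e) + (a + q * e)) + e ≡ (a + a) + (+ 1 + (q + q)) * e
    collect = solve-∀

Classified : List ℤ → Set
Classified A = CaseI A ⊎ CaseII A ⊎ CaseIII A ⊎ CaseIV A ⊎ CaseV A

reverse₃ : ∀ {x y z : ℤ} → x ∷ y ∷ z ∷ [] ↭ z ∷ y ∷ x ∷ []
reverse₃ {x} {y} {z} = ↭-sym (↭-reverse (x ∷ y ∷ z ∷ []))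

module _ {A : List ℤ} {f : ℕ → ℤ} (f↑ : StrictlyIncreasing f) (!A : Unique A) where

  extremal₃⇒CaseI : A ↭ applyUpTo f 3 → length (S₂ A) ≡ 2 → CaseI A
  extremal₃⇒CaseI A↭ S₂-length≡ with Enumerated.Extremal.zero-pair f↑ 1 A↭ S₂-length≡
  ... | 0 , 1 , _ , _ , z = zeroPair⇒CaseI !A (↭-trans A↭ reverse₃) (f↑ (s≤s z≤n)) z
  ... | 0 , 2 , _ , _ , z = zeroPair⇒CaseI !A
    (↭-trans A↭ (↭-trans (swap _ _ ↭-refl) (prep _ (swap _ _ ↭-refl)))) (f↑ (s≤s z≤n)) z
  ... | 1 , 2 , _ , _ , z = zeroPair⇒CaseI !A (↭-trans A↭ (prep _ (swap _ _ ↭-refl))) (f↑ ℕ.≤-refl) z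
  ... | _ , 0 , () , _ , _
  ... | suc _ , 1 , s≤s () , _ , _
  ... | suc (suc _) , 2 , s≤s (s≤s ()) , _ , _
  ... | _ , suc (suc (suc _)) , _ , s≤s (s≤s ()) , _

  module _ (A↭ : A ↭ applyUpTo f 4) (S₂-length≡ : length (S₂ A) ≡ 4) where
    open Enumerated f↑ 2 A↭
    open Extremal S₂-length≡

    parallelogram : f 1 + f 2 ≡ f 0 + f 3
    parallelogram = shift-row saturated ℕ.≤-refl ℕ.≤-refl

    extremal₄⇒CaseII⊎CaseIII : CaseII A ⊎ CaseIII A
    extremal₄⇒CaseII⊎CaseIII with zero-pair
    ... | 0 , 3 , _ , _ , z = inj₁ (zeroPairs⇒CaseII A↭ (f↑ ℕ.≤-refl) (f↑ ℕ.≤-refl) z (trans parallelogram z))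
    ... | 1 , 2 , _ , _ , z =
      inj₁ (zeroPairs⇒CaseII A↭ (f↑ ℕ.≤-refl) (f↑ ℕ.≤-refl) (trans (sym parallelogram) z) z)
    ... | 0 , 1 , _ , _ , z = inj₂ (zeroPair⇒CaseIII !A (↭-trans A↭ (prep _ (prep _ (swap _ _ ↭-refl))))
      (f↑ (s≤s z≤n)) z (sym parallelogram))
    ... | 0 , 2 , _ , _ , z = inj₂ (zeroPair⇒CaseIII !A
      (↭-trans A↭ (prep _ (↭-trans (swap _ _ ↭-refl) (prep _ (swap _ _ ↭-refl)))))
      (f↑ (s≤s z≤n)) z (trans (sym parallelogram) (ℤ.+-comm (f 1) (f 2))))
    ... | 1 , 3 , _ , _ , z = inj₂ (zeroPair⇒CaseIII !A
      (↭-trans A↭ (↭-trans (swap _ _ ↭-refl) (prep _ reverse₃)))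
      (f↑ (s≤s (s≤s z≤n))) z (trans parallelogram (ℤ.+-comm (f 0) (f 3))))
    ... | 2 , 3 , _ , _ , z = inj₂ (zeroPair⇒CaseIII !A
      (↭-trans A↭ (↭-trans (prep _ (swap _ _ ↭-refl)) (↭-trans (swap _ _ ↭-refl) (prep _ reverse₃))))
      (f↑ ℕ.≤-refl) z (trans (ℤ.+-comm (f 2) (f 1)) (trans parallelogram (ℤ.+-comm (f 0) (f 3)))))
    ... | _ , 0 , () , _ , _
    ... | suc _ , 1 , s≤s () , _ , _
    ... | suc (suc _) , 2 , s≤s (s≤s ()) , _ , _
    ... | suc (suc (suc _)) , 3 , s≤s (s≤s (s≤s ())) , _ , _
    ... | _ , suc (suc (suc (suc _))) , _ , s≤s (s≤s (s≤s ())) , _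

  module _ {l} (2<l : 2 ℕ.< l) (A↭ : A ↭ applyUpTo f (suc (suc l)))
           (S₂-length≡ : length (S₂ A) ≡ l ℕ.+ l) where
    open Enumerated f↑ l A↭
    open Extremal S₂-length≡

    f≡progression : ∀ k → k ℕ.≤ top → f k ≡ f 0 + + k * (f 1 - f 0)
    f≡progression = progression saturated 2<l

    A≐progression : A ≐ λ x → ∃ λ k → k ℕ.≤ top × x ≡ f 0 + + k * (f 1 - f 0)
    A≐progression x = mk⇔ to from
      where
      to : x ∈ A → ∃ λ k → k ℕ.≤ top × x ≡ f 0 + + k * (f 1 - f 0)
      to x∈A with ∈-applyUpTo⁻ f (∈-resp-↭ A↭ x∈A)
      ... | k , s≤s k≤top , refl = k , k≤top , f≡progression k k≤top
      from : (∃ λ k → k ℕ.≤ top × x ≡ f 0 + + k * (f 1 - f 0)) → x ∈ A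
      from (k , k≤top , refl) = subst (_∈ A) (f≡progression k k≤top) (f∈A k≤top)

    extremal⇒CaseIV⊎CaseV : CaseIV A ⊎ CaseV A
    extremal⇒CaseIV⊎CaseV with zero-pair
    ... | i , j , i<j , j≤top , fi+fj≡0 =
      Progression.zero-sum⇒CaseIV⊎CaseV (f 0) (f 1 - f 0) top e≢0 (s≤s 2<l) A≐progression i<j j≤top
        (subst₂ (λ x y → x + y ≡ 0ℤ) (f≡progression i (ℕ.<⇒≤ (ℕ.<-≤-trans i<j j≤top)))
          (f≡progression j j≤top) fi+fj≡0)
      where
      e≢0 : f 1 - f 0 ≢ 0ℤ
      e≢0 = ℤ.<⇒≢ (f↑ (s≤s z≤n)) ∘ sym ∘ ℤ.i-j≡0⇒i≡j (f 1) (f 0)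

  extremal⇒Classified : ∀ l → 1 ℕ.≤ l → A ↭ applyUpTo f (suc (suc l)) → length (S₂ A) ≡ l ℕ.+ l →
    Classified A
  extremal⇒Classified 1 _ A↭ = inj₁ ∘ extremal₃⇒CaseI A↭
  extremal⇒Classified 2 _ A↭ = inj₂ ∘ Sum.map₂ inj₁ ∘ extremal₄⇒CaseII⊎CaseIII A↭
  extremal⇒Classified (suc (suc (suc _))) _ A↭ =
    inj₂ ∘ inj₂ ∘ inj₂ ∘ extremal⇒CaseIV⊎CaseV (s≤s (s≤s (s≤s z≤n))) A↭

-- Sets of type (i)–(v) are extremal

-- |S₂ A| ≤ 2 |A| - 4, stated without truncated subtraction.
S₂-Bounded : List ℤ → Set
S₂-Bounded A = ∃ λ K → suc (suc K) ℕ.≤ length A × length (S₂ A) ℕ.≤ K ℕ.+ K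

S₂-Bounded⇒S₂-length≤ : ∀ {A l} → length A ≡ suc (suc l) → S₂-Bounded A → length (S₂ A) ℕ.≤ l ℕ.+ l
S₂-Bounded⇒S₂-length≤ |A|≡2+l (K , 2+K≤|A| , |S₂|≤2K) = ℕ.≤-trans |S₂|≤2K (ℕ.+-mono-≤ K≤l K≤l)
  where
  K≤l = ℕ.≤-pred (ℕ.≤-pred (subst (suc (suc _) ℕ.≤_) |A|≡2+l 2+K≤|A|))

CaseI⇒S₂-Bounded : ∀ {A} → CaseI A → S₂-Bounded A
CaseI⇒S₂-Bounded {A} (c , d , 0<d , ∣c∣≢∣d∣ , A≐) =
  1 , Unique-⊆⇒length≤ ℤ._≟_ elements-unique (λ x∈ → Equivalence.from (A≐ _) (Equivalence.to ∈-triple x∈)) ,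
  ℕ.≤-pred (S₂-length< sums∈ (here refl))
  where
  elements-unique : Unique (c ∷ d ∷ - d ∷ [])
  elements-unique =
    ((∣c∣≢∣d∣ ∘ cong ℤ.∣_∣) ∷ (λ c≡-d → ∣c∣≢∣d∣ (trans (cong ℤ.∣_∣ c≡-d) (ℤ.∣-i∣≡∣i∣ d))) ∷ []) ∷
    (pos≢neg 0<d 0<d ∷ []) ∷ [] ∷ []
  sums∈ : ∀ {x} → DistinctSum A x → x ∈ 0ℤ ∷ c + d ∷ c - d ∷ []
  sums∈ (a , b , a∈A , b∈A , a≢b , refl) with Equivalence.to (A≐ a) a∈A | Equivalence.to (A≐ b) b∈A
  ... | inj₁ refl        | inj₁ refl        = contradiction refl a≢b
  ... | inj₁ refl        | inj₂ (inj₁ refl) = there (here refl)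
  ... | inj₁ refl        | inj₂ (inj₂ refl) = there (there (here refl))
  ... | inj₂ (inj₁ refl) | inj₁ refl        = there (here (ℤ.+-comm d c))
  ... | inj₂ (inj₁ refl) | inj₂ (inj₁ refl) = contradiction refl a≢b
  ... | inj₂ (inj₁ refl) | inj₂ (inj₂ refl) = here (ℤ.+-inverseʳ d)
  ... | inj₂ (inj₂ refl) | inj₁ refl        = there (there (here (ℤ.+-comm (- d) c)))
  ... | inj₂ (inj₂ refl) | inj₂ (inj₁ refl) = here (ℤ.+-inverseˡ d)
  ... | inj₂ (inj₂ refl) | inj₂ (inj₂ refl) = contradiction refl a≢b

pattern ι₀ p = inj₁ p
pattern ι₁ p = inj₂ (inj₁ p)
pattern ι₂ p = inj₂ (inj₂ (inj₁ p))
pattern ι₃ p = inj₂ (inj₂ (inj₂ p))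

CaseII⇒S₂-Bounded : ∀ {A} → CaseII A → S₂-Bounded A
CaseII⇒S₂-Bounded {A} (c , d , 0<c , 0<d , c≢d , A≐) =
  2 , Unique-⊆⇒length≤ ℤ._≟_ elements-unique (λ x∈ → Equivalence.from (A≐ _) (Equivalence.to ∈-quadruple x∈)) ,
  ℕ.≤-pred (S₂-length< sums∈ (here refl))
  where
  elements-unique : Unique (c ∷ - c ∷ d ∷ - d ∷ [])
  elements-unique =
    (pos≢neg 0<c 0<c ∷ c≢d ∷ pos≢neg 0<c 0<d ∷ []) ∷
    ((pos≢neg 0<d 0<c ∘ sym) ∷ (c≢d ∘ ℤ.neg-injective) ∷ []) ∷
    (pos≢neg 0<d 0<d ∷ []) ∷ [] ∷ []
  sums∈ : ∀ {x} → DistinctSum A x → x ∈ 0ℤ ∷ c + d ∷ c - d ∷ - c + d ∷ - c - d ∷ []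
  sums∈ (a , b , a∈A , b∈A , a≢b , refl) with Equivalence.to (A≐ a) a∈A | Equivalence.to (A≐ b) b∈A
  ... | ι₀ refl | ι₀ refl = contradiction refl a≢b
  ... | ι₀ refl | ι₁ refl = here (ℤ.+-inverseʳ c)
  ... | ι₀ refl | ι₂ refl = there (here refl)
  ... | ι₀ refl | ι₃ refl = there (there (here refl))
  ... | ι₁ refl | ι₀ refl = here (ℤ.+-inverseˡ c)
  ... | ι₁ refl | ι₁ refl = contradiction refl a≢b
  ... | ι₁ refl | ι₂ refl = there (there (there (here refl)))
  ... | ι₁ refl | ι₃ refl = there (there (there (there (here refl))))
  ... | ι₂ refl | ι₀ refl = there (here (ℤ.+-comm d c))
  ... | ι₂ refl | ι₁ refl = there (there (there (here (ℤ.+-comm d (- c)))))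
  ... | ι₂ refl | ι₂ refl = contradiction refl a≢b
  ... | ι₂ refl | ι₃ refl = here (ℤ.+-inverseʳ d)
  ... | ι₃ refl | ι₀ refl = there (there (here (ℤ.+-comm (- d) c)))
  ... | ι₃ refl | ι₁ refl = there (there (there (there (here (ℤ.+-comm (- d) (- c))))))
  ... | ι₃ refl | ι₂ refl = here (ℤ.+-inverseˡ d)
  ... | ι₃ refl | ι₃ refl = contradiction refl a≢b

CaseIII⇒S₂-Bounded : ∀ {A} → CaseIII A → S₂-Bounded A
CaseIII⇒S₂-Bounded {A} (c , d , 0<d , c≢0 , c≢2d , c≢-2d , A≐) =
  2 , Unique-⊆⇒length≤ ℤ._≟_ elements-unique (λ x∈ → Equivalence.from (A≐ _) (Equivalence.to ∈-quadruple x∈)) ,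
  ℕ.≤-pred (S₂-length< sums∈ (here refl))
  where
  twice-minus : ∀ d → + 2 * d - d ≡ d
  twice-minus = solve-∀
  neg-twice-plus : ∀ d → - (+ 2 * d) + d ≡ - d
  neg-twice-plus = solve-∀
  elements-unique : Unique (d ∷ - d ∷ c + d ∷ c - d ∷ [])
  elements-unique =
    (pos≢neg 0<d 0<d ∷
     (λ eq → c≢0 (∙-cancelʳ d c 0ℤ (trans (sym eq) (sym (ℤ.+-identityˡ d))))) ∷
     (λ eq → c≢2d (∙-cancelʳ (- d) c (+ 2 * d) (trans (sym eq) (sym (twice-minus d))))) ∷ []) ∷
    ((λ eq → c≢-2d (∙-cancelʳ d c (- (+ 2 * d)) (trans (sym eq) (sym (neg-twice-plus d))))) ∷
     (λ eq → c≢0 (∙-cancelʳ (- d) c 0ℤ (trans (sym eq) (sym (ℤ.+-identityˡ (- d)))))) ∷ []) ∷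
    ((pos≢neg 0<d 0<d ∘ ∙-cancelˡ c d (- d)) ∷ []) ∷ [] ∷ []
  centre₁ : ∀ c d → d + (c - d) ≡ c
  centre₁ = solve-∀
  centre₂ : ∀ c d → - d + (c + d) ≡ c
  centre₂ = solve-∀
  centre₃ : ∀ c d → (c + d) + - d ≡ c
  centre₃ = solve-∀
  centre₄ : ∀ c d → (c - d) + d ≡ c
  centre₄ = solve-∀
  sums∈ : ∀ {x} → DistinctSum A x → x ∈ 0ℤ ∷ d + (c + d) ∷ c ∷ - d + (c - d) ∷ (c + d) + (c - d) ∷ []
  sums∈ (a , b , a∈A , b∈A , a≢b , refl) with Equivalence.to (A≐ a) a∈A | Equivalence.to (A≐ b) b∈A
  ... | ι₀ refl | ι₀ refl = contradiction refl a≢b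
  ... | ι₀ refl | ι₁ refl = here (ℤ.+-inverseʳ d)
  ... | ι₀ refl | ι₂ refl = there (here refl)
  ... | ι₀ refl | ι₃ refl = there (there (here (centre₁ c d)))
  ... | ι₁ refl | ι₀ refl = here (ℤ.+-inverseˡ d)
  ... | ι₁ refl | ι₁ refl = contradiction refl a≢b
  ... | ι₁ refl | ι₂ refl = there (there (here (centre₂ c d)))
  ... | ι₁ refl | ι₃ refl = there (there (there (here refl)))
  ... | ι₂ refl | ι₀ refl = there (here (ℤ.+-comm (c + d) d))
  ... | ι₂ refl | ι₁ refl = there (there (here (centre₃ c d)))
  ... | ι₂ refl | ι₂ refl = contradiction refl a≢b
  ... | ι₂ refl | ι₃ refl = there (there (there (there (here refl))))
  ... | ι₃ refl | ι₀ refl = there (there (here (centre₄ c d)))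
  ... | ι₃ refl | ι₁ refl = there (there (there (here (ℤ.+-comm (c - d) (- d)))))
  ... | ι₃ refl | ι₂ refl = there (there (there (there (here (ℤ.+-comm (c - d) (c + d))))))
  ... | ι₃ refl | ι₃ refl = contradiction refl a≢b

-- A sum of two distinct elements g r + g r′ is h ρ with 2s < ρ < 2t; if one such h ρ is 0 this
-- leaves at most 2(t - s) - 2 nonzero values.
module Image {A : List ℤ} (g h : ℤ → ℤ) (s : ℤ) (K : ℕ)
  (A≐ : A ≐ λ x → ∃ λ r → s ℤ.≤ r × r ℤ.≤ s + + suc K × x ≡ g r)
  (g-injective : ∀ {r r′} → g r ≡ g r′ → r ≡ r′)
  (g+g≡h : ∀ r r′ → g r + g r′ ≡ h (r + r′)) where

  t : ℤ
  t = s + + suc K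

  length≥ : suc (suc K) ℕ.≤ length A
  length≥ = subst (ℕ._≤ length A) (length-applyUpTo (λ k → g (s + + k)) (suc (suc K)))
    (Unique-⊆⇒length≤ ℤ._≟_
      (applyUpTo⁺₁ _ _ λ i<j _ → ℤ.<⇒≢ (ℤ.+-monoʳ-< s (ℤ.+<+ i<j)) ∘ g-injective) values⊆A)
    where
    values⊆A : applyUpTo (λ k → g (s + + k)) (suc (suc K)) ⊆ A
    values⊆A x∈ with ∈-applyUpTo⁻ (λ k → g (s + + k)) x∈
    ... | k , s≤s k≤1+K , refl =
      Equivalence.from (A≐ _) (Equivalence.to (reindex (λ r → g (s + + k) ≡ g r)) (k , k≤1+K , refl))

  S₂-length≤ : ∀ {ρ₀} → h ρ₀ ≡ 0ℤ → s + s ℤ.< ρ₀ → ρ₀ ℤ.< t + t → length (S₂ A) ℕ.≤ K ℕ.+ K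
  S₂-length≤ {ρ₀} hρ₀≡0 2s<ρ₀ ρ₀<2t = ℕ.≤-pred (subst (length (S₂ A) ℕ.<_) length-cover
    (S₂-length< sums∈cover (subst (_∈ cover) hρ₀≡0 (∈-map⁺ h (between 2s<ρ₀ ρ₀<2t)))))
    where
    sums : List ℤ
    sums = interval (ℤ.suc (s + s)) (suc (K ℕ.+ K))
    cover : List ℤ
    cover = map h sums
    length-cover : length cover ≡ suc (K ℕ.+ K)
    length-cover = trans (length-map h sums) (length-applyUpTo (λ k → ℤ.suc (s + s) + + k) (suc (K ℕ.+ K)))
    between : ∀ {ρ} → s + s ℤ.< ρ → ρ ℤ.< t + t → ρ ∈ sums
    between 2s<ρ ρ<2t = ∈-interval⁺ (ℤ.i<j⇒suc[i]≤j 2s<ρ) (subst (_ ℤ.<_) (ends s (+ K)) ρ<2t)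
      where
      ends : ∀ s K → (s + (+ 1 + K)) + (s + (+ 1 + K)) ≡ (+ 1 + (s + s)) + (+ 1 + (K + K))
      ends = solve-∀
    sums∈cover : ∀ {x} → DistinctSum A x → x ∈ cover
    sums∈cover (a , b , a∈A , b∈A , a≢b , refl)
      with Equivalence.to (A≐ a) a∈A | Equivalence.to (A≐ b) b∈A
    ... | r , s≤r , r≤t , refl | r′ , s≤r′ , r′≤t , refl
      with distinct-sum-bounds s≤r r≤t s≤r′ r′≤t (a≢b ∘ cong g)
    ... | 2s<ρ , ρ<2t = subst (_∈ cover) (sym (g+g≡h r r′)) (∈-map⁺ h (between 2s<ρ ρ<2t))

CaseIV⇒S₂-Bounded : ∀ {A} → CaseIV A → S₂-Bounded A
CaseIV⇒S₂-Bounded (d , s , t , d≢0 , s≤-1 , 1≤t , 4≤t-s , A≐)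
  with offset-suc {s} {t} (ℤ.≤-trans (ℤ.+≤+ (s≤s z≤n)) 4≤t-s)
... | K , refl = K , length≥ , S₂-length≤ {0ℤ} refl 2s<0 0<2t
  where
  open Image (_* d) (_* d) s K A≐ (λ {r} {r′} → ℤ.*-cancelʳ-≡ r r′ d {{ℤ.≢-nonZero d≢0}})
    (λ r r′ → sym (ℤ.*-distribʳ-+ d r r′)) using (length≥; S₂-length≤)
  2s<0 : s + s ℤ.< 0ℤ
  2s<0 = ℤ.+-mono-<-≤ {s} {0ℤ} (ℤ.≤-<-trans s≤-1 ℤ.-<+) (ℤ.≤-trans s≤-1 ℤ.-≤+)
  0<2t : 0ℤ ℤ.< t + t
  0<2t = ℤ.+-mono-<-≤ (ℤ.<-≤-trans (ℤ.+<+ (s≤s z≤n)) 1≤t) (ℤ.≤-trans (ℤ.+≤+ z≤n) 1≤t)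

CaseV⇒S₂-Bounded : ∀ {A} → CaseV A → S₂-Bounded A
CaseV⇒S₂-Bounded (d , s , t , d≢0 , s≤0 , 1≤t , 4≤t-s , A≐)
  with offset-suc {s} {t} (ℤ.≤-trans (ℤ.+≤+ (s≤s z≤n)) 4≤t-s)
... | K , refl = K , length≥ , S₂-length≤ {+ 1} refl
  (ℤ.≤-<-trans (ℤ.+-mono-≤ s≤0 s≤0) (ℤ.+<+ (s≤s z≤n)))
  (ℤ.<-≤-trans (ℤ.+<+ (s≤s (s≤s z≤n))) (ℤ.+-mono-≤ 1≤t 1≤t))
  where
  odd : ℤ → ℤ
  odd r = (+ 2 * r - + 1) * d
  odd-injective : ∀ {r r′} → odd r ≡ odd r′ → r ≡ r′
  odd-injective {r} {r′} eq = ℤ.*-cancelˡ-≡ (+ 2) r r′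
    (∙-cancelʳ (- + 1) (+ 2 * r) (+ 2 * r′) (ℤ.*-cancelʳ-≡ _ _ d {{ℤ.≢-nonZero d≢0}} eq))
  odd+odd : ∀ r r′ → odd r + odd r′ ≡ (+ 2 * ((r + r′) - + 1)) * d
  odd+odd r r′ = collect r r′ d
    where
    collect : ∀ r r′ d → (+ 2 * r - + 1) * d + (+ 2 * r′ - + 1) * d ≡ (+ 2 * ((r + r′) - + 1)) * d
    collect = solve-∀
  open Image odd (λ ρ → (+ 2 * (ρ - + 1)) * d) s K A≐ odd-injective odd+odd using (length≥; S₂-length≤)

Classified⇒S₂-Bounded : ∀ {A} → Classified A → S₂-Bounded A
Classified⇒S₂-Bounded = [ CaseI⇒S₂-Bounded , [ CaseII⇒S₂-Bounded , [ CaseIII⇒S₂-Bounded ,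
  [ CaseIV⇒S₂-Bounded , CaseV⇒S₂-Bounded ] ] ] ]

theorem1p3 : (A : List ℤ) → Unique A → 3 ℕ.≤ length A →
    (length (S₂ A) ≡ 2 ℕ.* length A ℕ.∸ 4) ⇔
    (CaseI A ⊎ CaseII A ⊎ CaseIII A ⊎ CaseIV A ⊎ CaseV A)
theorem1p3 A !A 3≤|A| with sortedEnumeration !A
... | f , f↑ , A↭ = mk⇔
  (extremal⇒Classified f↑ !A l 1≤l A↭′ ∘ (λ |S₂|≡ → trans |S₂|≡ bound≡l+l))
  (λ classified → trans (ℕ.≤-antisym
    (S₂-Bounded⇒S₂-length≤ {A} |A|≡2+l (Classified⇒S₂-Bounded classified))
    (Enumerated.S₂-length≥ f↑ l A↭′)) (sym bound≡l+l))
  where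
  l = length A ℕ.∸ 2
  |A|≡2+l : length A ≡ suc (suc l)
  |A|≡2+l = sym (ℕ.m+[n∸m]≡n (ℕ.≤-trans (s≤s (s≤s z≤n)) 3≤|A|))
  1≤l : 1 ℕ.≤ l
  1≤l = ℕ.∸-monoˡ-≤ 2 3≤|A|
  A↭′ : A ↭ applyUpTo f (suc (suc l))
  A↭′ = subst (λ n → A ↭ applyUpTo f n) |A|≡2+l A↭
  bound≡l+l : 2 ℕ.* length A ℕ.∸ 4 ≡ l ℕ.+ l
  bound≡l+l = trans (cong (λ n → 2 ℕ.* n ℕ.∸ 4) |A|≡2+l) (2*[2+l]∸4≡l+l l)
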